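{- No $(r,c)$-graph exists for $(r,c) \in \{(5,7), (5,8), (6,11)\}$.
   Context: All graphs are finite and simple. For a vertex $v$, $e(v)$ denotes the number of edges of the subgraph induced by the open neighbourhood of $v$. An $(r,c)$-graph is an $r$-regular graph with $e(v) = c$ for every vertex $v$. -}

module Defs where

open import Data.Nat using (ℕ; zero; suc; _<ᵇ_)
open import Data.Bool using (Bool; true; false; _∧_)
open import Data.Fin using (Fin; toℕ)
open import Data.List using (List; map; allFin)
open import Data.Nat.ListAction using (sum)
open import Data.Product using (_×_)
open import Relation.Binary.PropositionalEquality using (_≡_)

record Graph (n : ℕ) : Set where
  field
    adj    : Fin n → Fin n → Bool
    sym    : ∀ u v → adj u v ≡ adj v u
    irrefl : ∀ v → adj v v ≡ false

bit : Bool → ℕ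
bit true  = 1
bit false = 0

countFin : (n : ℕ) → (Fin n → Bool) → ℕ
countFin n p = sum (map (λ u → bit (p u)) (allFin n))

module _ {n : ℕ} (G : Graph n) where
  open Graph G

  deg : Fin n → ℕ
  deg v = countFin n (adj v)

  -- e(v): number of edges of the subgraph induced by the open neighbourhood
  -- of v, counting each edge {u,w} once (as the pair with toℕ u < toℕ w).
  e : Fin n → ℕ
  e v = sum (map (λ u → countFin n (λ w →
          (toℕ u <ᵇ toℕ w) ∧ (adj v u ∧ (adj v w ∧ adj u w)))) (allFin n))

  Regular : ℕ → Set
  Regular r = ∀ v → deg v ≡ r

  IsRCGraph : ℕ → ℕ → Set
  IsRCGraph r c = Regular r × (∀ v → e v ≡ c)

{-# OPTIONS --safe #-}

-- Fix a vertex v of an (r,c)-graph G and let H be the graph induced on its r neighbours; H has c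
-- edges. For a neighbour u of v, the neighbourhood of u consists of v, the set K of common
-- neighbours of u and v, and a set X of r - 1 - |K| vertices outside N(v) ∪ {v}. The edges inside
-- N(u) are the |K| edges at v, the e(K) edges inside K, at most ∑_{x ∈ K} (r - 1 - deg_H x) edges
-- between K and X (a vertex of K has exactly that many neighbours outside N(v) ∪ {v}), and at most
-- binom(|X|, 2) edges inside X. This upper bound on e(u) = c depends only on H and u, and an
-- exhaustive search shows that every graph H on 5 (resp. 6) vertices with c = 7 or 8 (resp. 11)
-- edges has a vertex u where the bound is smaller than c.

module Submission where

open import Defs
open import Data.Nat using (ℕ; zero; suc; _+_; _*_; _∸_; _≤_; _<_; z≤n; _<ᵇ_; _<?_)
import Data.Nat as ℕ
open import Data.Nat.Properties
  using ( +-0-commutativeMonoid; +-commutativeSemigroup; +-identityʳ; +-mono-≤; +-monoʳ-≤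
        ; *-identityʳ; ≤-refl; ≤-trans; ≤-reflexive; ≤-<-trans; <-irrefl; m+n∸m≡n; module ≤-Reasoning)
open import Data.Nat.Solver using (module +-*-Solver)
import Data.Nat.ListAction as ListAction using (sum)
open import Algebra.Properties.CommutativeMonoid.Sum +-0-commutativeMonoid
  using (sum; sum-syntax; sum-cong-≗; sum-replicate-zero; ∑-distrib-+; ∑-comm)
open import Algebra.Properties.CommutativeSemigroup +-commutativeSemigroup using (x∙yz≈y∙xz)
open import Data.Bool using (Bool; true; false; if_then_else_; not; _∧_)
open import Data.Bool.Properties using (∧-zeroʳ; not-injective)
open import Data.Fin using (Fin; zero; suc; toℕ)
open import Data.Fin.Properties using (_≟_; any?)
open import Data.List using (List; []; _∷_; [_]; cartesianProductWith)
import Data.List as List using (tabulate; map; allFin)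
open import Data.List.Properties using (map-tabulate)
open import Data.List.Membership.Propositional using (_∈_)
open import Data.List.Membership.Propositional.Properties using (∈-cartesianProductWith⁺)
open import Data.List.Relation.Unary.All as All using (all?)
open import Data.List.Relation.Unary.Any using (here; there)
open import Data.Product using (_×_; _,_; ∃-syntax)
open import Data.Sum using (_⊎_; inj₁; inj₂)
open import Data.Vec.Functional as Vector using (Vector)
open import Function using (_∘_; id)
open import Relation.Binary.PropositionalEquality
  using (_≡_; refl; sym; trans; cong; cong₂; subst; module ≡-Reasoning)
open import Relation.Nullary using (¬_; Dec; does; yes; no; _→-dec_)
open import Relation.Nullary.Decidable using (True; toWitness)

private variable
  n l : ℕ

-- Sums over Fin and over Boolean subsets

sum-tabulate : (f : Fin n → ℕ) → ListAction.sum (List.tabulate f) ≡ ∑[ i < n ] f i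
sum-tabulate {zero}  f = refl
sum-tabulate {suc n} f = cong (f zero +_) (sum-tabulate (f ∘ suc))

sum-map-allFin : (f : Fin n → ℕ) → ListAction.sum (List.map f (List.allFin n)) ≡ ∑[ i < n ] f i
sum-map-allFin f = trans (cong ListAction.sum (map-tabulate id f)) (sum-tabulate f)

∑-mono-≤ : {f g : Fin n → ℕ} → (∀ i → f i ≤ g i) → ∑[ i < n ] f i ≤ ∑[ i < n ] g i
∑-mono-≤ {zero}  f≤g = z≤n
∑-mono-≤ {suc n} f≤g = +-mono-≤ (f≤g zero) (∑-mono-≤ (f≤g ∘ suc))

∣_∣ : Vector Bool n → ℕ
∣ P ∣ = ∑[ x < _ ] bit (P x)

_∩_ : Vector Bool n → Vector Bool n → Vector Bool n
(P ∩ Q) x = P x ∧ Q x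

∧-trueˡ : ∀ {a b} → a ∧ b ≡ true → a ≡ true
∧-trueˡ {true} _ = refl

∧-trueʳ : ∀ {a b} → a ∧ b ≡ true → b ≡ true
∧-trueʳ {true} ab = ab

∑∈ : Vector Bool n → (Fin n → ℕ) → ℕ
∑∈ P f = ∑[ x < _ ] (if P x then f x else 0)

syntax ∑∈ P (λ x → f) = ∑[ x ∈ P ] f

∑∈-const : (P : Vector Bool n) (c : ℕ) → ∑[ x ∈ P ] c ≡ ∣ P ∣ * c
∑∈-const {zero}  P c = refl
∑∈-const {suc n} P c =
  trans (cong ((if P zero then c else 0) +_) (∑∈-const (P ∘ suc) c)) (head-term (P zero))
  where
  head-term : ∀ b → (if b then c else 0) + ∣ P ∘ suc ∣ * c ≡ (bit b + ∣ P ∘ suc ∣) * c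
  head-term true  = refl
  head-term false = refl

module _ (P : Vector Bool n) where

  ∑∈-cong : {f g : Fin n → ℕ} → (∀ x → P x ≡ true → f x ≡ g x) →
            ∑[ x ∈ P ] f x ≡ ∑[ x ∈ P ] g x
  ∑∈-cong {f} {g} f≡g = sum-cong-≗ pointwise
    where
    pointwise : ∀ x → (if P x then f x else 0) ≡ (if P x then g x else 0)
    pointwise x with P x in Px
    ... | true  = f≡g x Px
    ... | false = refl

  ∑∈-mono-≤ : {f g : Fin n → ℕ} → (∀ x → P x ≡ true → f x ≤ g x) →
              ∑[ x ∈ P ] f x ≤ ∑[ x ∈ P ] g x
  ∑∈-mono-≤ {f} {g} f≤g = ∑-mono-≤ pointwise
    where
    pointwise : ∀ x → (if P x then f x else 0) ≤ (if P x then g x else 0)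
    pointwise x with P x in Px
    ... | true  = f≤g x Px
    ... | false = z≤n

  ∑∈-distrib-+ : (f g : Fin n → ℕ) →
                 ∑[ x ∈ P ] (f x + g x) ≡ ∑[ x ∈ P ] f x + ∑[ x ∈ P ] g x
  ∑∈-distrib-+ f g =
    trans (sum-cong-≗ pointwise)
          (∑-distrib-+ (λ x → if P x then f x else 0) (λ x → if P x then g x else 0))
    where
    pointwise : ∀ x → (if P x then f x + g x else 0) ≡
                      (if P x then f x else 0) + (if P x then g x else 0)
    pointwise x with P x
    ... | true  = refl
    ... | false = refl

  ∑∈-∩ : (Q : Vector Bool n) (f : Fin n → ℕ) →
         ∑[ x ∈ P ∩ Q ] f x ≡ ∑[ x ∈ P ] (if Q x then f x else 0)
  ∑∈-∩ Q f = sum-cong-≗ pointwise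
    where
    pointwise : ∀ x → (if P x ∧ Q x then f x else 0) ≡
                      (if P x then (if Q x then f x else 0) else 0)
    pointwise x with P x
    ... | true  = refl
    ... | false = refl

  ∣∩∣ : (Q : Vector Bool n) → ∣ P ∩ Q ∣ ≡ ∑[ x ∈ P ] bit (Q x)
  ∣∩∣ Q = sum-cong-≗ pointwise
    where
    pointwise : ∀ x → bit (P x ∧ Q x) ≡ (if P x then bit (Q x) else 0)
    pointwise x with P x
    ... | true  = refl
    ... | false = refl

  ∑∈-mono-⊆ : {Q : Vector Bool n} → (∀ x → P x ≡ true → Q x ≡ true) →
              (f : Fin n → ℕ) → ∑[ x ∈ P ] f x ≤ ∑[ x ∈ Q ] f x
  ∑∈-mono-⊆ {Q} P⊆Q f = ∑-mono-≤ pointwise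
    where
    pointwise : ∀ x → (if P x then f x else 0) ≤ (if Q x then f x else 0)
    pointwise x with P x in Px
    ... | false = z≤n
    ... | true rewrite P⊆Q x Px = ≤-refl

∑∈-resp : {P Q : Vector Bool n} {f g : Fin n → ℕ} → (∀ x → P x ≡ Q x) → (∀ x → f x ≡ g x) →
          ∑[ x ∈ P ] f x ≡ ∑[ x ∈ Q ] g x
∑∈-resp P≡Q f≡g = sum-cong-≗ λ x → cong₂ (λ b y → if b then y else 0) (P≡Q x) (f≡g x)

∑∈-comm : {m : ℕ} (P : Vector Bool m) (Q : Vector Bool n) (g : Fin m → Fin n → ℕ) →
          ∑[ x ∈ P ] ∑[ y ∈ Q ] g x y ≡ ∑[ y ∈ Q ] ∑[ x ∈ P ] g x y
∑∈-comm {n = n} {m = m} P Q g = begin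
  ∑[ x ∈ P ] ∑[ y ∈ Q ] g x y
    ≡⟨ sum-cong-≗ (λ x → if-∑ (P x) (λ y → if Q y then g x y else 0)) ⟩
  ∑[ x < m ] ∑[ y < n ] (if P x then (if Q y then g x y else 0) else 0)
    ≡⟨ ∑-comm (λ x y → if P x then (if Q y then g x y else 0) else 0) ⟩
  ∑[ y < n ] ∑[ x < m ] (if P x then (if Q y then g x y else 0) else 0)
    ≡⟨ sum-cong-≗ (λ y → sum-cong-≗ (λ x → swap (P x) (Q y) (g x y))) ⟩
  ∑[ y < n ] ∑[ x < m ] (if Q y then (if P x then g x y else 0) else 0)
    ≡⟨ sum-cong-≗ (λ y → if-∑ (Q y) (λ x → if P x then g x y else 0)) ⟨
  ∑[ y ∈ Q ] ∑[ x ∈ P ] g x y ∎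
  where
  open ≡-Reasoning
  if-∑ : ∀ {l} b (h : Fin l → ℕ) →
         (if b then ∑[ y < l ] h y else 0) ≡ ∑[ y < l ] (if b then h y else 0)
  if-∑ {l} true  h = refl
  if-∑ {l} false h = sym (sum-replicate-zero l)
  swap : ∀ a b c → (if a then (if b then c else 0) else 0) ≡ (if b then (if a then c else 0) else 0)
  swap true  b c = refl
  swap false true  c = refl
  swap false false c = refl

allBut : Fin n → Vector Bool n
allBut v x = not (does (x ≟ v))

∑-allBut : (v : Fin n) (f : Fin n → ℕ) → ∑[ x < n ] f x ≡ f v + ∑[ x ∈ allBut v ] f x
∑-allBut {suc n} zero    f = refl
∑-allBut {suc n} (suc v) f =
  trans (cong (f zero +_) (∑-allBut v (f ∘ suc))) (x∙yz≈y∙xz (f zero) (f (suc v)) _)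

record Enumeration (P : Vector Bool n) (k : ℕ) : Set where
  field
    elem    : Fin k → Fin n
    elem∈   : ∀ i → P (elem i) ≡ true
    reindex : (f : Fin n → ℕ) → ∑[ x ∈ P ] f x ≡ ∑[ i < k ] f (elem i)

enumeration : (P : Vector Bool n) → Enumeration P ∣ P ∣
enumeration {zero}  P = record { elem = λ () ; elem∈ = λ () ; reindex = λ _ → refl }
enumeration {suc n} P = cons (enumeration (P ∘ suc))
  where
  open Enumeration
  cons : Enumeration (P ∘ suc) l → Enumeration P (bit (P zero) + l)
  cons E with P zero in P0
  ... | true = record
    { elem    = λ { zero → zero ; (suc i) → suc (elem E i) }
    ; elem∈   = λ { zero → P0 ; (suc i) → elem∈ E i }
    ; reindex = λ f → cong₂ _+_ (cong (λ b → if b then f zero else 0) P0) (reindex E (f ∘ suc))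
    }
  ... | false = record
    { elem    = suc ∘ elem E
    ; elem∈   = elem∈ E
    ; reindex = λ f → cong₂ _+_ (cong (λ b → if b then f zero else 0) P0) (reindex E (f ∘ suc))
    }

enumerate : (P : Vector Bool n) → ∣ P ∣ ≡ l → Enumeration P l
enumerate P refl = enumeration P

∑∑-symmetric : (S : Fin n → Fin n → Bool) → (∀ x y → S x y ≡ S y x) → (∀ x → S x x ≡ false) →
               ∑[ x < n ] ∑[ y < n ] bit (S x y) ≡
               2 * ∑[ x < n ] ∑[ y < n ] bit ((toℕ x <ᵇ toℕ y) ∧ S x y)
∑∑-symmetric {n} S S-sym S-irrefl = begin
  ∑[ x < n ] ∑[ y < n ] bit (S x y)
    ≡⟨ sum-cong-≗ (λ x → sum-cong-≗ (λ y → split x y)) ⟩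
  ∑[ x < n ] ∑[ y < n ] (upper x y + upper y x)
    ≡⟨ sum-cong-≗ (λ x → ∑-distrib-+ (upper x) (λ y → upper y x)) ⟩
  ∑[ x < n ] (∑[ y < n ] upper x y + ∑[ y < n ] upper y x)
    ≡⟨ ∑-distrib-+ (λ x → ∑[ y < n ] upper x y) (λ x → ∑[ y < n ] upper y x) ⟩
  A + ∑[ x < n ] ∑[ y < n ] upper y x
    ≡⟨ cong (A +_) (∑-comm (λ x y → upper y x)) ⟩
  A + A
    ≡⟨ cong (A +_) (+-identityʳ A) ⟨
  2 * A ∎
  where
  open ≡-Reasoning
  upper : Fin n → Fin n → ℕ
  upper x y = bit ((toℕ x <ᵇ toℕ y) ∧ S x y)
  A : ℕ
  A = ∑[ x < n ] ∑[ y < n ] upper x y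
  trichotomy : ∀ {m} (x y : Fin m) b → (x ≡ y → b ≡ false) →
               bit b ≡ bit ((toℕ x <ᵇ toℕ y) ∧ b) + bit ((toℕ y <ᵇ toℕ x) ∧ b)
  trichotomy zero    zero    b x≡y→b = cong bit (x≡y→b refl)
  trichotomy zero    (suc y) b _     = sym (+-identityʳ (bit b))
  trichotomy (suc x) zero    b _     = refl
  trichotomy (suc x) (suc y) b x≡y→b = trichotomy x y b (x≡y→b ∘ cong suc)
  split : ∀ x y → bit (S x y) ≡ upper x y + upper y x
  split x y = trans (trichotomy x y (S x y) (λ { refl → S-irrefl x }))
    (cong (λ b → upper x y + bit ((toℕ y <ᵇ toℕ x) ∧ b)) (S-sym x y))

-- Counting neighbours and arcs in a graph

module _ (G : Graph n) where
  open Graph G renaming (sym to adj-sym)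

  degree : Fin n → ℕ
  degree x = ∣ adj x ∣

  degreeIn : Vector Bool n → Fin n → ℕ
  degreeIn Q x = ∑[ y ∈ Q ] bit (adj x y)

  arcs : Vector Bool n → Vector Bool n → ℕ
  arcs P Q = ∑[ x ∈ P ] degreeIn Q x

  nonNeighbours : Fin n → Vector Bool n
  nonNeighbours v = allBut v ∩ (not ∘ adj v)

  ∑-split-at : (v : Fin n) (f : Fin n → ℕ) →
               ∑[ x < n ] f x ≡ f v + (∑[ x ∈ adj v ] f x + ∑[ x ∈ nonNeighbours v ] f x)
  ∑-split-at v f = trans (∑-allBut v f) (cong (f v +_) (trans (sum-cong-≗ partition)
    (∑-distrib-+ (λ x → if adj v x then f x else 0) (λ x → if nonNeighbours v x then f x else 0))))
    where
    partition : ∀ x → (if not (does (x ≟ v)) then f x else 0) ≡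
                      (if adj v x then f x else 0) + (if not (does (x ≟ v)) ∧ not (adj v x) then f x else 0)
    partition x with x ≟ v
    ... | yes refl rewrite irrefl x = refl
    ... | no _ with adj v x
    ...   | true  = sym (+-identityʳ (f x))
    ...   | false = refl

  ∑∈-split-at : (v : Fin n) {P : Vector Bool n} → P v ≡ true → (f : Fin n → ℕ) →
                ∑[ x ∈ P ] f x ≡
                f v + (∑[ x ∈ adj v ∩ P ] f x + ∑[ x ∈ nonNeighbours v ∩ P ] f x)
  ∑∈-split-at v {P} Pv f = trans (∑-split-at v (λ x → if P x then f x else 0))
    (cong₂ _+_ (cong (λ b → if b then f v else 0) Pv)
               (sym (cong₂ _+_ (∑∈-∩ (adj v) P f) (∑∈-∩ (nonNeighbours v) P f))))

  arcs-comm : (P Q : Vector Bool n) → arcs P Q ≡ arcs Q P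
  arcs-comm P Q = trans (∑∈-comm P Q (λ x y → bit (adj x y)))
    (∑∈-cong Q λ y _ → ∑∈-cong P λ x _ → cong bit (adj-sym x y))

  degreeIn-adj-comm : (x y : Fin n) → degreeIn (adj x) y ≡ degreeIn (adj y) x
  degreeIn-adj-comm x y = sum-cong-≗ λ z → masked-bit-comm (adj x z) (adj y z)
    where
    masked-bit-comm : ∀ a b → (if a then bit b else 0) ≡ (if b then bit a else 0)
    masked-bit-comm true  true  = refl
    masked-bit-comm true  false = refl
    masked-bit-comm false true  = refl
    masked-bit-comm false false = refl

  degreeIn-self-≤ : {P : Vector Bool n} {x : Fin n} → P x ≡ true → degreeIn P x ≤ ∣ P ∣ ∸ 1
  degreeIn-self-≤ {P} {x} Px = begin
    degreeIn P x
      ≡⟨ ∑-allBut x _ ⟩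
    (if P x then bit (adj x x) else 0) + rest
      ≡⟨ cong (λ b → (if P x then bit b else 0) + rest) (irrefl x) ⟩
    (if P x then 0 else 0) + rest
      ≡⟨ cong (λ b → (if b then 0 else 0) + rest) Px ⟩
    rest
      ≤⟨ ∑∈-mono-≤ (allBut x) (λ y _ → masked-bit-≤ (P y) (adj x y)) ⟩
    others
      ≡⟨ cong (λ b → (bit b + others) ∸ 1) Px ⟨
    (bit (P x) + others) ∸ 1
      ≡⟨ cong (_∸ 1) (∑-allBut x (bit ∘ P)) ⟨
    ∣ P ∣ ∸ 1 ∎
    where
    open ≤-Reasoning
    rest others : ℕ
    rest   = ∑[ y ∈ allBut x ] (if P y then bit (adj x y) else 0)
    others = ∑[ y ∈ allBut x ] bit (P y)
    masked-bit-≤ : ∀ a b → (if a then bit b else 0) ≤ bit a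
    masked-bit-≤ true  true  = ≤-refl
    masked-bit-≤ true  false = z≤n
    masked-bit-≤ false b     = z≤n

  arcs-self-≤ : (P : Vector Bool n) → arcs P P ≤ ∣ P ∣ * (∣ P ∣ ∸ 1)
  arcs-self-≤ P =
    ≤-trans (∑∈-mono-≤ P λ _ Px → degreeIn-self-≤ Px) (≤-reflexive (∑∈-const P (∣ P ∣ ∸ 1)))

  twice-e : (u : Fin n) → 2 * e G u ≡ arcs (adj u) (adj u)
  twice-e u = begin
    2 * e G u
      ≡⟨ cong (2 *_) e≡∑∑ ⟩
    2 * ∑[ x < n ] ∑[ y < n ] bit ((toℕ x <ᵇ toℕ y) ∧ S x y)
      ≡⟨ ∑∑-symmetric S S-sym S-irrefl ⟨
    ∑[ x < n ] ∑[ y < n ] bit (S x y)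
      ≡⟨ sum-cong-≗ (λ x → masked (adj u x) (adj x)) ⟩
    arcs (adj u) (adj u) ∎
    where
    open ≡-Reasoning
    S : Fin n → Fin n → Bool
    S x y = adj u x ∧ (adj u y ∧ adj x y)
    e≡∑∑ : e G u ≡ ∑[ x < n ] ∑[ y < n ] bit ((toℕ x <ᵇ toℕ y) ∧ S x y)
    e≡∑∑ = trans (sum-map-allFin (λ x → countFin n (λ y → (toℕ x <ᵇ toℕ y) ∧ S x y)))
                 (sum-cong-≗ λ x → sum-map-allFin (λ y → bit ((toℕ x <ᵇ toℕ y) ∧ S x y)))
    S-sym : ∀ x y → S x y ≡ S y x
    S-sym x y rewrite adj-sym x y with adj u x | adj u y
    ... | true  | true  = refl
    ... | true  | false = refl
    ... | false | true  = refl
    ... | false | false = refl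
    S-irrefl : ∀ x → S x x ≡ false
    S-irrefl x rewrite irrefl x | ∧-zeroʳ (adj u x) = ∧-zeroʳ (adj u x)
    masked : ∀ a (R : Vector Bool n) →
             ∑[ y < n ] bit (a ∧ (adj u y ∧ R y)) ≡ (if a then ∑[ y ∈ adj u ] bit (R y) else 0)
    masked true  R = ∣∩∣ (adj u) R
    masked false R = sum-replicate-zero n

-- The local bound at a neighbour of v

-- 2 e(u) ≤ twiceEdgeBound r k a s for k = |K|, a = 2 e(K) and s = ∑_{x ∈ K} (r - 1 - deg_H x);
-- the last term is |X| (|X| - 1).
twiceEdgeBound : (r k a s : ℕ) → ℕ
twiceEdgeBound r k a s = 2 * k + a + 2 * s + (r ∸ 1 ∸ k) * (r ∸ 1 ∸ k ∸ 1)

module _ (G : Graph n) {r : ℕ} (regular : ∀ x → degree G x ≡ r) where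
  open Graph G renaming (sym to adj-sym)

  degreeIn-nonNeighbours : {v x : Fin n} → adj v x ≡ true →
                           degreeIn G (nonNeighbours G v) x ≡ r ∸ 1 ∸ degreeIn G (adj v) x
  degreeIn-nonNeighbours {v} {x} vx = begin
    b              ≡⟨ m+n∸m≡n a b ⟨
    a + b ∸ a      ≡⟨ cong (λ t → t ∸ 1 ∸ a) 1+a+b≡r ⟩
    r ∸ 1 ∸ a      ∎
    where
    open ≡-Reasoning
    a b : ℕ
    a = degreeIn G (adj v) x
    b = degreeIn G (nonNeighbours G v) x
    1+a+b≡r : suc (a + b) ≡ r
    1+a+b≡r = begin
      suc (a + b)                ≡⟨ cong (λ c → bit c + (a + b)) (trans (adj-sym x v) vx) ⟨
      bit (adj x v) + (a + b)    ≡⟨ ∑-split-at G v (bit ∘ adj x) ⟨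
      degree G x                 ≡⟨ regular x ⟩
      r                          ∎

  module Local {v u : Fin n} (vu : adj v u ≡ true) where

    common outer : Vector Bool n
    common = adj v ∩ adj u
    outer  = nonNeighbours G v ∩ adj u

    k m : ℕ
    k = degreeIn G (adj v) u
    m = r ∸ 1 ∸ k

    outgoing : ℕ
    outgoing = ∑[ x ∈ common ] (r ∸ 1 ∸ degreeIn G (adj v) x)

    common⇒adj : ∀ {x} → common x ≡ true → adj v x ≡ true
    common⇒adj = ∧-trueˡ

    outer⇒nonNeighbour : ∀ {x} → outer x ≡ true → nonNeighbours G v x ≡ true
    outer⇒nonNeighbour = ∧-trueˡ

    outer⇒¬adj : ∀ {x} → outer x ≡ true → adj v x ≡ false
    outer⇒¬adj {x} x∈outer = not-injective (∧-trueʳ {not (does (x ≟ v))} (outer⇒nonNeighbour x∈outer))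

    degreeIn-split : ∀ x → degreeIn G (adj u) x ≡ bit (adj v x) + (degreeIn G common x + degreeIn G outer x)
    degreeIn-split x =
      trans (∑∈-split-at G v (trans (adj-sym u v) vu) (bit ∘ adj x))
            (cong (λ b → bit b + (degreeIn G common x + degreeIn G outer x)) (adj-sym x v))

    arcs-common : ∑[ x ∈ common ] degreeIn G (adj u) x ≡ k + (arcs G common common + arcs G common outer)
    arcs-common = begin
      ∑[ x ∈ common ] degreeIn G (adj u) x
        ≡⟨ ∑∈-cong common (λ x x∈common → trans (degreeIn-split x)
             (cong (λ b → bit b + (degreeIn G common x + degreeIn G outer x)) (common⇒adj x∈common))) ⟩
      ∑[ x ∈ common ] (1 + (degreeIn G common x + degreeIn G outer x))
        ≡⟨ ∑∈-distrib-+ common (λ _ → 1) _ ⟩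
      ∑[ x ∈ common ] 1 + ∑[ x ∈ common ] (degreeIn G common x + degreeIn G outer x)
        ≡⟨ cong₂ _+_ size (∑∈-distrib-+ common (degreeIn G common) (degreeIn G outer)) ⟩
      k + (arcs G common common + arcs G common outer) ∎
      where
      open ≡-Reasoning
      size : ∑[ x ∈ common ] 1 ≡ k
      size = trans (∑∈-const common 1) (trans (*-identityʳ _) (∣∩∣ (adj v) (adj u)))

    arcs-outer : ∑[ x ∈ outer ] degreeIn G (adj u) x ≡ arcs G common outer + arcs G outer outer
    arcs-outer = begin
      ∑[ x ∈ outer ] degreeIn G (adj u) x
        ≡⟨ ∑∈-cong outer (λ x x∈outer → trans (degreeIn-split x)
             (cong (λ b → bit b + (degreeIn G common x + degreeIn G outer x))
                   (outer⇒¬adj x∈outer))) ⟩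
      ∑[ x ∈ outer ] (degreeIn G common x + degreeIn G outer x)
        ≡⟨ ∑∈-distrib-+ outer (degreeIn G common) (degreeIn G outer) ⟩
      arcs G outer common + arcs G outer outer
        ≡⟨ cong (_+ arcs G outer outer) (arcs-comm G outer common) ⟩
      arcs G common outer + arcs G outer outer ∎
      where open ≡-Reasoning

    arcs-common-outer-≤ : arcs G common outer ≤ outgoing
    arcs-common-outer-≤ = ∑∈-mono-≤ common λ x x∈common →
      ≤-trans (∑∈-mono-⊆ outer (λ _ → outer⇒nonNeighbour) (bit ∘ adj x))
              (≤-reflexive (degreeIn-nonNeighbours (common⇒adj x∈common)))

    arcs-outer-≤ : arcs G outer outer ≤ m * (m ∸ 1)
    arcs-outer-≤ = ≤-trans (arcs-self-≤ G outer) (≤-reflexive (cong (λ t → t * (t ∸ 1)) size))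
      where
      size : ∣ outer ∣ ≡ m
      size = trans (∣∩∣ (nonNeighbours G v) (adj u)) (degreeIn-nonNeighbours vu)

    twice-e-≤ : 2 * e G u ≤ twiceEdgeBound r k (arcs G common common) outgoing
    twice-e-≤ = begin
      2 * e G u
        ≡⟨ twice-e G u ⟩
      arcs G (adj u) (adj u)
        ≡⟨ ∑∈-split-at G v (trans (adj-sym u v) vu) (degreeIn G (adj u)) ⟩
      degreeIn G (adj u) v + (∑[ x ∈ common ] degreeIn G (adj u) x + ∑[ x ∈ outer ] degreeIn G (adj u) x)
        ≡⟨ cong₂ _+_ (degreeIn-adj-comm G u v) (cong₂ _+_ arcs-common arcs-outer) ⟩
      k + ((k + (cc + co)) + (co + oo))
        ≤⟨ +-monoʳ-≤ k (+-mono-≤ (+-monoʳ-≤ k (+-monoʳ-≤ cc arcs-common-outer-≤))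
                                 (+-mono-≤ arcs-common-outer-≤ arcs-outer-≤)) ⟩
      k + ((k + (cc + outgoing)) + (outgoing + m * (m ∸ 1)))
        ≡⟨ rearrange k cc outgoing (m * (m ∸ 1)) ⟩
      twiceEdgeBound r k cc outgoing ∎
      where
      open ≤-Reasoning
      open +-*-Solver
      cc co oo : ℕ
      cc = arcs G common common
      co = arcs G common outer
      oo = arcs G outer outer
      rearrange : ∀ a b c d → a + ((a + (b + c)) + (c + d)) ≡ 2 * a + b + 2 * c + d
      rearrange = solve 4 (λ a b c d → a :+ ((a :+ (b :+ c)) :+ (c :+ d)) := con 2 :* a :+ b :+ con 2 :* c :+ d) refl

induced : Graph n → (Fin l → Fin n) → Graph l
induced G a = record
  { adj    = λ i j → adj (a i) (a j)
  ; sym    = λ i j → Graph.sym G (a i) (a j)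
  ; irrefl = irrefl ∘ a
  }
  where open Graph G using (adj; irrefl)

-- Meant for the neighbourhood graph H of v, whose number of vertices is the degree r.
localBound : Graph n → Fin n → ℕ
localBound {n} H u =
  twiceEdgeBound n (degree H u) (arcs H (adj u) (adj u)) (∑[ x ∈ adj u ] (n ∸ 1 ∸ degree H x))
  where open Graph H

module _ (G : Graph n) {r : ℕ} (regular : ∀ x → degree G x ≡ r)
         (v : Fin n) (E : Enumeration (Graph.adj G v) r) where
  open Graph G using (adj)
  open Enumeration E

  neighbourhood : Graph r
  neighbourhood = induced G elem

  private
    H = neighbourhood

    degreeIn-elem : ∀ i → degreeIn G (adj v) (elem i) ≡ degree H i
    degreeIn-elem i = reindex (bit ∘ adj (elem i))

    ∑∈-common : ∀ i (f : Fin n → ℕ) →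
                ∑[ x ∈ adj v ∩ adj (elem i) ] f x ≡ ∑[ j ∈ Graph.adj H i ] f (elem j)
    ∑∈-common i f = trans (∑∈-∩ (adj v) (adj (elem i)) f) (reindex _)

  twice-e-centre : 2 * e G v ≡ ∑[ i < r ] degree H i
  twice-e-centre = trans (twice-e G v) (trans (reindex (degreeIn G (adj v))) (sum-cong-≗ degreeIn-elem))

  twice-e-≤-localBound : ∀ i → 2 * e G (elem i) ≤ localBound H i
  twice-e-≤-localBound i = begin
    2 * e G (elem i)
      ≤⟨ twice-e-≤ ⟩
    twiceEdgeBound r k (arcs G common common) outgoing
      ≡⟨ cong₂ (λ k a → twiceEdgeBound r k a outgoing) (degreeIn-elem i) arcs≡ ⟩
    twiceEdgeBound r (degree H i) (arcs H N N) outgoing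
      ≡⟨ cong (twiceEdgeBound r (degree H i) (arcs H N N)) outgoing≡ ⟩
    localBound H i ∎
    where
    open ≤-Reasoning
    open Local G regular (elem∈ i)
    N : Vector Bool r
    N = Graph.adj H i
    arcs≡ : arcs G common common ≡ arcs H N N
    arcs≡ = trans (∑∈-common i _) (∑∈-cong N λ j _ → ∑∈-common i _)
    outgoing≡ : outgoing ≡ ∑[ j ∈ N ] (r ∸ 1 ∸ degree H j)
    outgoing≡ = trans (∑∈-common i _) (∑∈-cong N λ j _ → cong (r ∸ 1 ∸_) (degreeIn-elem j))

-- Exhaustive search over small graphs

_≈_ : Graph n → Graph n → Set
H ≈ H′ = ∀ i j → Graph.adj H i j ≡ Graph.adj H′ i j

Excluded : Graph n → ℕ → Set
Excluded {n} H c = ∑[ x < n ] degree H x ≡ 2 * c → ∃[ u ] localBound H u < 2 * c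

excluded? : (H : Graph n) (c : ℕ) → Dec (Excluded H c)
excluded? {n} H c = (∑[ x < n ] degree H x ℕ.≟ 2 * c) →-dec any? (λ u → localBound H u <? 2 * c)

module _ {H H′ : Graph n} (H≈H′ : H ≈ H′) where

  degree-resp : ∀ x → degree H x ≡ degree H′ x
  degree-resp x = sum-cong-≗ λ y → cong bit (H≈H′ x y)

  localBound-resp : ∀ u → localBound H u ≡ localBound H′ u
  localBound-resp u = begin
    twiceEdgeBound n (degree H u) (arcs H N N) (outgoing H)
      ≡⟨ cong₂ (λ k a → twiceEdgeBound n k a (outgoing H)) (degree-resp u) arcs≡ ⟩
    twiceEdgeBound n (degree H′ u) (arcs H′ N′ N′) (outgoing H)
      ≡⟨ cong (twiceEdgeBound n (degree H′ u) (arcs H′ N′ N′)) outgoing≡ ⟩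
    twiceEdgeBound n (degree H′ u) (arcs H′ N′ N′) (outgoing H′) ∎
    where
    open ≡-Reasoning
    N N′ : Vector Bool n
    N  = Graph.adj H u
    N′ = Graph.adj H′ u
    outgoing : Graph n → ℕ
    outgoing K = ∑[ x ∈ Graph.adj K u ] (n ∸ 1 ∸ degree K x)
    arcs≡ : arcs H N N ≡ arcs H′ N′ N′
    arcs≡ = ∑∈-resp (H≈H′ u) λ x → ∑∈-resp (H≈H′ u) λ y → cong bit (H≈H′ x y)
    outgoing≡ : outgoing H ≡ outgoing H′
    outgoing≡ = ∑∈-resp (H≈H′ u) λ x → cong (n ∸ 1 ∸_) (degree-resp x)

  Excluded-resp : ∀ {c} → Excluded H′ c → Excluded H c
  Excluded-resp {c} excluded degrees≡ with excluded (trans (sym (sum-cong-≗ degree-resp)) degrees≡)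
  ... | u , bound< = u , subst (_< 2 * c) (sym (localBound-resp u)) bound<

emptyGraph : Graph 0
emptyGraph = record { adj = λ () ; sym = λ () ; irrefl = λ () }

extend : (Fin n → Bool) → Graph n → Graph (suc n)
extend {n} row H = record { adj = adj′ ; sym = sym′ ; irrefl = irrefl′ }
  where
  open Graph H
  adj′ : Fin (suc n) → Fin (suc n) → Bool
  adj′ = (false Vector.∷ row) Vector.∷ λ i → row i Vector.∷ adj i
  sym′ : ∀ i j → adj′ i j ≡ adj′ j i
  sym′ zero    zero    = refl
  sym′ zero    (suc j) = refl
  sym′ (suc i) zero    = refl
  sym′ (suc i) (suc j) = Graph.sym H i j
  irrefl′ : ∀ i → adj′ i i ≡ false
  irrefl′ zero    = refl
  irrefl′ (suc i) = irrefl i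

subsets : (n : ℕ) → List (Fin n → Bool)
subsets zero    = [ (λ ()) ]
subsets (suc n) = cartesianProductWith Vector._∷_ (true ∷ false ∷ []) (subsets n)

graphs : (n : ℕ) → List (Graph n)
graphs zero    = [ emptyGraph ]
graphs (suc n) = cartesianProductWith extend (subsets n) (graphs n)

∈-subsets : (P : Fin n → Bool) → ∃[ Q ] Q ∈ subsets n × (∀ i → P i ≡ Q i)
∈-subsets {zero}  P = (λ ()) , here refl , λ ()
∈-subsets {suc n} P with ∈-subsets (P ∘ suc)
... | Q , Q∈ , P≡Q =
  P zero Vector.∷ Q , ∈-cartesianProductWith⁺ Vector._∷_ (bool∈ (P zero)) Q∈ , pointwise
  where
  bool∈ : ∀ b → b ∈ true ∷ false ∷ []
  bool∈ true  = here refl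
  bool∈ false = there (here refl)
  pointwise : ∀ i → P i ≡ (P zero Vector.∷ Q) i
  pointwise zero    = refl
  pointwise (suc i) = P≡Q i

∈-graphs : (H : Graph n) → ∃[ H′ ] H′ ∈ graphs n × H ≈ H′
∈-graphs {zero}  H = emptyGraph , here refl , λ ()
∈-graphs {suc n} H with ∈-subsets (λ j → Graph.adj H zero (suc j)) | ∈-graphs (induced H suc)
... | row , row∈ , row≡ | H′ , H′∈ , H≈H′ =
  extend row H′ , ∈-cartesianProductWith⁺ extend row∈ H′∈ , pointwise
  where
  open Graph H
  pointwise : H ≈ extend row H′
  pointwise zero    zero    = irrefl zero
  pointwise zero    (suc j) = row≡ j
  pointwise (suc i) zero    = trans (Graph.sym H (suc i) zero) (row≡ i)
  pointwise (suc i) (suc j) = H≈H′ i j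

everyGraphExcluded : ∀ r c → {True (all? (λ H → excluded? H c) (graphs r))} → (H : Graph r) → Excluded H c
everyGraphExcluded r c {ok} H with ∈-graphs H
... | H′ , H′∈ , H≈H′ = Excluded-resp {H = H} {H′} H≈H′ {c} (All.lookup (toWitness ok) H′∈)

no-rc-graph : ∀ {r c} → (∀ (H : Graph r) → Excluded H c) → (G : Graph n) → Fin n → ¬ IsRCGraph G r c
no-rc-graph {n} {r} {c} excluded G v (regular , e≡c) =
  let u , bound< = excluded H twice-c≡ in <-irrefl refl (≤-<-trans (twice-c≤ u) bound<)
  where
  open Graph G using (adj)
  regular′ : ∀ x → degree G x ≡ r
  regular′ x = trans (sym (sum-map-allFin (λ y → bit (adj x y)))) (regular x)
  E : Enumeration (adj v) r
  E = enumerate (adj v) (regular′ v)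
  H : Graph r
  H = neighbourhood G regular′ v E
  twice-c≡ : ∑[ i < r ] degree H i ≡ 2 * c
  twice-c≡ = trans (sym (twice-e-centre G regular′ v E)) (cong (2 *_) {e G v} (e≡c v))
  twice-c≤ : ∀ u → 2 * c ≤ localBound H u
  twice-c≤ u = subst (_≤ localBound H u) (cong (2 *_) {e G (Enumeration.elem E u)} (e≡c (Enumeration.elem E u)))
                     (twice-e-≤-localBound G regular′ v E u)

proposition4p2 : (r c : ℕ) →
    ((r ≡ 5 × c ≡ 7) ⊎ (r ≡ 5 × c ≡ 8) ⊎ (r ≡ 6 × c ≡ 11)) →
    (n : ℕ) (G : Graph (suc n)) → ¬ IsRCGraph G r c
proposition4p2 _ _ (inj₁ (refl , refl))        _ G = no-rc-graph (everyGraphExcluded 5 7) G zero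
proposition4p2 _ _ (inj₂ (inj₁ (refl , refl))) _ G = no-rc-graph (everyGraphExcluded 5 8) G zero
proposition4p2 _ _ (inj₂ (inj₂ (refl , refl))) _ G = no-rc-graph (everyGraphExcluded 6 11) G zero
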